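{- Let $A$ be a partition of $\omega$ into finite sets such that there is no common finite upper bound on the cardinalities of the members of $A$. Then $E_{(A)}\approx E_\le$.
   Context: $E=\mathrm{Self}(\omega)$ is the monoid of maps $\omega\to\omega$ ($\omega$ the natural numbers), written on the right. For $U\subseteq E$ and a partition $A$ of $\omega$, $U_{(A)}=\{f\in U:(\Sigma)f\subseteq\Sigma\ \forall\Sigma\in A\}$. $E_\le=\{f\in E:(\alpha)f\le\alpha\ \forall\alpha\in\omega\}$. $\langle X\rangle$ is the generated submonoid; $M_1\approx M_2$ means there exist finite $U,V\subseteq E$ with $M_1\subseteq\langle M_2\cup U\rangle$ and $M_2\subseteq\langle M_1\cup V\rangle$. -}

module Defs where

open import Data.Nat using (ℕ; _≤_; _<_; suc)
open import Data.List using (List; []; _∷_; length)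
open import Data.List.Membership.Propositional using (_∈_)
open import Data.List.Relation.Unary.All using (All)
open import Data.List.Relation.Unary.Unique.Propositional using (Unique)
open import Data.Product using (Σ; ∃; _×_)
open import Data.Sum using (_⊎_)
open import Relation.Binary.PropositionalEquality using (_≡_)

-- E = Self(ω): maps ω → ω, written on the right.
E : Set
E = ℕ → ℕ

Sub : Set₁
Sub = E → Set

prod : List E → E
prod []       α = α
prod (g ∷ gs) α = prod gs (g α)

⟨_⟩ : Sub → Sub
⟨ X ⟩ f = Σ (List E) λ gs → All X gs × (∀ α → f α ≡ prod gs α)

_∪L_ : Sub → List E → Sub
(X ∪L U) f = X f ⊎ f ∈ U

_⊆_ : Sub → Sub → Set
M₁ ⊆ M₂ = ∀ f → M₁ f → M₂ f

_≈E_ : Sub → Sub → Set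
M₁ ≈E M₂ = Σ (List E) λ U → Σ (List E) λ V →
  (M₁ ⊆ ⟨ M₂ ∪L U ⟩) × (M₂ ⊆ ⟨ M₁ ∪L V ⟩)

-- A partition of ω is represented by a block-labelling c : ℕ → ℕ;
-- the blocks are the nonempty fibres of c, i.e. α and β lie in the
-- same block iff c α ≡ c β.

-- U_(A) = { f ∈ U : (Σ)f ⊆ Σ for every block Σ }.
_⦅_⦆ : Sub → (ℕ → ℕ) → Sub
(U ⦅ c ⦆) f = U f × (∀ α → c (f α) ≡ c α)

Eall : Sub
Eall _ = Data.Unit.⊤
  where import Data.Unit

E≤ : Sub
E≤ f = ∀ α → f α ≤ α

FiniteBlocks : (ℕ → ℕ) → Set
FiniteBlocks c = ∀ k → ∃ λ b → ∀ α → c α ≡ k → α < b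

UnboundedBlocks : (ℕ → ℕ) → Set
UnboundedBlocks c = ∀ m → Σ ℕ λ k → Σ (List ℕ) λ xs →
  Unique xs × All (λ α → c α ≡ k) xs × (suc m ≤ length xs)

-- Both inclusions are witnessed by factorisations through a few fixed maps.
-- A map f preserving the (finite) blocks is u g, where u is an injection sending
-- every α above its own block and g sends (α)u to (α)f (fixing points outside
-- the image of u); as (α)f lies in the block of α, g is decreasing.  Conversely,
-- unbounded block sizes give pairwise disjoint "stages" S₀ < S₁ < …, where Sₐ
-- consists of a + 1 points (a , 0) … (a , a) of a single block.  A decreasing g
-- is then p h q with p α = (α , α), q (a , j) = j and h (a , j) = (a , (a)g),
-- and h preserves the blocks since it moves points only within a stage
-- (u = aboveBlock, p = diagonal, h = moveWithinStage g, q = column).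
module Submission where

open import Defs
open import Data.Nat using (ℕ; zero; suc; _+_; _≤_; _<_; z≤n; s≤s; s≤s⁻¹)
open import Data.Nat.Properties
open import Data.Fin as Fin using (Fin; toℕ; fromℕ; fromℕ<; inject≤)
open import Data.Fin.Properties using (any?; inject≤-injective; toℕ-fromℕ<)
open import Data.List using (List; []; _∷_; length; lookup; filter; upTo; _++_)
open import Data.List.Properties using (length-++; length-applyUpTo; filter-notAll)
open import Data.List.Extrema.Nat using (max; xs≤max; v≤max⁺)
open import Data.List.Membership.Propositional using (_∈_)
open import Data.List.Membership.Propositional.Properties
  using (∈-filter⁺; ∈-++⁺ˡ; ∈-++⁺ʳ; ∈-upTo⁺; ∈-lookup)
open import Data.List.Relation.Unary.All as All using (All; []; _∷_)
import Data.List.Relation.Unary.All.Properties as All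
open import Data.List.Relation.Unary.Any as Any using (here; there)
open import Data.List.Relation.Unary.AllPairs using (_∷_)
open import Data.List.Relation.Unary.Unique.Propositional using (Unique)
import Data.List.Relation.Unary.Unique.Propositional.Properties as Unique
open import Data.Product using (Σ; ∃; _,_; proj₁; proj₂)
open import Data.Sum using (inj₁; inj₂)
open import Data.Unit using (tt)
open import Function using (_∘_)
open import Function.Definitions using (Injective)
open import Relation.Binary using (DecidableEquality; tri<; tri≈; tri>)
open import Relation.Binary.PropositionalEquality
open import Relation.Nullary using (Dec; yes; no; ¬_; ¬?; contradiction)
open import Relation.Nullary.Decidable using (map′)
open import Relation.Unary using (Decidable)

module StrictlyIncreasing (u : ℕ → ℕ) (u-step : ∀ n → u n < u (suc n)) where

  mono-< : ∀ {m n} → m < n → u m < u n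
  mono-< {m} {suc n} m<1+n with m≤n⇒m<n∨m≡n (s≤s⁻¹ m<1+n)
  ... | inj₁ m<n  = <-trans (mono-< m<n) (u-step n)
  ... | inj₂ refl = u-step n

  mono-≤ : ∀ {m n} → m ≤ n → u m ≤ u n
  mono-≤ m≤n with m≤n⇒m<n∨m≡n m≤n
  ... | inj₁ m<n  = <⇒≤ (mono-< m<n)
  ... | inj₂ refl = ≤-refl

  injective : Injective _≡_ _≡_ u
  injective {m} {n} um≡un with <-cmp m n
  ... | tri< m<n _ _ = contradiction um≡un (<⇒≢ (mono-< m<n))
  ... | tri≈ _ m≡n _ = m≡n
  ... | tri> _ _ n<m = contradiction (sym um≡un) (<⇒≢ (mono-< n<m))

  inflationary : ∀ n → n ≤ u n
  inflationary zero    = z≤n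
  inflationary (suc n) = <-≤-trans (s≤s (inflationary n)) (u-step n)

∃-bounded? : {P : ℕ → Set} → Decidable P → ∀ b → (∀ {n} → P n → n ≤ b) → Dec (∃ P)
∃-bounded? P? b bounded =
  map′ (λ (n , _ , pn) → n , pn) (λ (n , pn) → n , s≤s (bounded pn) , pn) (anyUpTo? P? (suc b))

length-mono-⊆ : ∀ {A : Set} → DecidableEquality A → ∀ {xs ys : List A} →
                Unique xs → (∀ {z} → z ∈ xs → z ∈ ys) → length xs ≤ length ys
length-mono-⊆ _≟ᴬ_ {[]}          _            _     = z≤n
length-mono-⊆ _≟ᴬ_ {x ∷ xs} {ys} (x∉xs ∷ xs!) xs⊆ys = begin-strict
  length xs               ≤⟨ length-mono-⊆ _≟ᴬ_ xs! xs⊆ys-x ⟩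
  length (filter ≢x? ys)  <⟨ filter-notAll ≢x? ys x∈ys ⟩
  length ys               ∎
  where
  open ≤-Reasoning
  ≢x? : Decidable (λ y → ¬ y ≡ x)
  ≢x? y = ¬? (y ≟ᴬ x)
  x∈ys : Any.Any (λ y → ¬ ¬ y ≡ x) ys
  x∈ys = Any.map (λ x≡y y≢x → y≢x (sym x≡y)) (xs⊆ys (here refl))
  xs⊆ys-x : ∀ {z} → z ∈ xs → z ∈ filter ≢x? ys
  xs⊆ys-x z∈xs = ∈-filter⁺ ≢x? (xs⊆ys (there z∈xs)) (λ z≡x → All.lookup x∉xs z∈xs (sym z≡x))

lookup-injective : ∀ {A : Set} {xs : List A} → Unique xs → Injective _≡_ _≡_ (lookup xs)
lookup-injective {xs = x ∷ xs} _          {Fin.zero}  {Fin.zero}  _  = refl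
lookup-injective {xs = x ∷ xs} (x∉xs ∷ _) {Fin.zero}  {Fin.suc j} eq =
  contradiction eq (All.lookup x∉xs (∈-lookup j))
lookup-injective {xs = x ∷ xs} (x∉xs ∷ _) {Fin.suc i} {Fin.zero}  eq =
  contradiction (sym eq) (All.lookup x∉xs (∈-lookup i))
lookup-injective {xs = x ∷ xs} (_ ∷ xs!)  {Fin.suc i} {Fin.suc j} eq =
  cong Fin.suc (lookup-injective xs! eq)

module ExtendAlong {X : Set} (ι : X → ℕ) (ι-injective : Injective _≡_ _≡_ ι)
                   (preimage? : ∀ β → Dec (∃ λ x → ι x ≡ β)) where

  extend : (X → ℕ) → E
  extend φ β with preimage? β
  ... | yes (x , _) = φ x
  ... | no _        = β

  extend-ι : ∀ φ x → extend φ (ι x) ≡ φ x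
  extend-ι φ x with preimage? (ι x)
  ... | yes (y , ιy≡ιx) = cong φ (ι-injective ιy≡ιx)
  ... | no ∄            = contradiction (x , refl) ∄

  extend-preserves : (R : ℕ → ℕ → Set) (φ : X → ℕ) → (∀ x → R (ι x) (φ x)) →
                     (∀ β → R β β) → ∀ β → R β (extend φ β)
  extend-preserves R φ Rιφ Rrefl β with preimage? β
  ... | yes (x , refl) = Rιφ x
  ... | no _           = Rrefl β

module BlockPreserving (c : ℕ → ℕ) (finite : FiniteBlocks c) where

  blockBound : ℕ → ℕ
  blockBound n = proj₁ (finite (c n))

  <blockBound : ∀ {α β} → c α ≡ c β → α < blockBound β
  <blockBound {α} {β} cα≡cβ = proj₂ (finite (c β)) α cα≡cβ

  aboveBlock : E
  aboveBlock zero    = blockBound zero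
  aboveBlock (suc n) = suc (aboveBlock n + blockBound (suc n))

  aboveBlock-step : ∀ n → aboveBlock n < aboveBlock (suc n)
  aboveBlock-step n = s≤s (m≤m+n (aboveBlock n) _)

  blockBound≤aboveBlock : ∀ n → blockBound n ≤ aboveBlock n
  blockBound≤aboveBlock zero    = ≤-refl
  blockBound≤aboveBlock (suc n) = m≤n⇒m≤1+n (m≤n+m _ (aboveBlock n))

  open StrictlyIncreasing aboveBlock aboveBlock-step

  preimage? : ∀ β → Dec (∃ λ α → aboveBlock α ≡ β)
  preimage? β = ∃-bounded? (λ α → aboveBlock α ≟ β) β
                           (λ {α} eq → subst (α ≤_) eq (inflationary α))

  open ExtendAlong aboveBlock injective preimage?

  extend-decreasing : ∀ f → (Eall ⦅ c ⦆) f → E≤ (extend f)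
  extend-decreasing f (_ , f-preserves) =
    extend-preserves (λ β v → v ≤ β) f
      (λ α → <⇒≤ (<-≤-trans (<blockBound (f-preserves α)) (blockBound≤aboveBlock α)))
      (λ _ → ≤-refl)

  preserving⊆⟨decreasing∪aboveBlock⟩ : (Eall ⦅ c ⦆) ⊆ ⟨ E≤ ∪L (aboveBlock ∷ []) ⟩
  preserving⊆⟨decreasing∪aboveBlock⟩ f f∈E⦅c⦆ =
    aboveBlock ∷ extend f ∷ [] ,
    inj₂ (here refl) ∷ inj₁ (extend-decreasing f f∈E⦅c⦆) ∷ [] ,
    λ α → sym (extend-ι f α)

unique⇒length≤+length-filter≥ : ∀ lo {xs} → Unique xs →
                                length xs ≤ lo + length (filter (lo ≤?_) xs)
unique⇒length≤+length-filter≥ lo {xs} xs! = begin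
  length xs                       ≤⟨ length-mono-⊆ _≟_ xs! xs⊆ ⟩
  length (upTo lo ++ above)       ≡⟨ length-++ (upTo lo) ⟩
  length (upTo lo) + length above ≡⟨ cong (_+ length above) (length-applyUpTo (λ n → n) lo) ⟩
  lo + length above               ∎
  where
  open ≤-Reasoning
  above : List ℕ
  above = filter (lo ≤?_) xs
  xs⊆ : ∀ {z} → z ∈ xs → z ∈ upTo lo ++ above
  xs⊆ {z} z∈xs with lo ≤? z
  ... | yes lo≤z = ∈-++⁺ʳ (upTo lo) (∈-filter⁺ (lo ≤?_) z∈xs lo≤z)
  ... | no  lo≰z = ∈-++⁺ˡ (∈-upTo⁺ (≰⇒> lo≰z))

module DecreasingMaps (c : ℕ → ℕ) (unbounded : UnboundedBlocks c) where

  record Sample (lo n : ℕ) : Set where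
    field
      points  : List ℕ
      block   : ℕ
      unique  : Unique points
      inBlock : All (λ y → c y ≡ block) points
      above   : All (lo ≤_) points
      large   : n < length points

  sample : ∀ lo n → Sample lo n
  sample lo n with unbounded (lo + n)
  ... | k , xs , xs! , xs∈k , lo+n<|xs| = record
    { points  = filter (lo ≤?_) xs
    ; block   = k
    ; unique  = Unique.filter⁺ (lo ≤?_) xs!
    ; inBlock = All.filter⁺ (lo ≤?_) xs∈k
    ; above   = All.all-filter (lo ≤?_) xs
    ; large   = +-cancelˡ-≤ lo _ _ (begin
        lo + suc n                       ≡⟨ +-suc lo n ⟩
        suc (lo + n)                     ≤⟨ lo+n<|xs| ⟩
        length xs                        ≤⟨ unique⇒length≤+length-filter≥ lo xs! ⟩
        lo + length (filter (lo ≤?_) xs) ∎)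
    }
    where open ≤-Reasoning

  threshold : ℕ → ℕ
  stage : ∀ a → Sample (threshold a) a

  threshold zero    = 0
  threshold (suc a) = suc (max (threshold a) (Sample.points (stage a)))

  stage a = sample (threshold a) a

  threshold-step : ∀ a → threshold a < threshold (suc a)
  threshold-step a = s≤s (v≤max⁺ (threshold a) (Sample.points (stage a)) (inj₁ ≤-refl))

  open StrictlyIncreasing threshold threshold-step using (mono-≤; inflationary)

  Triangle : Set
  Triangle = Σ ℕ λ a → Fin (suc a)

  point : Triangle → ℕ
  point (a , j) = lookup points (inject≤ j large)
    where open Sample (stage a)

  point-∈ : ∀ a j → point (a , j) ∈ Sample.points (stage a)
  point-∈ a j = ∈-lookup _

  point-block : ∀ a j → c (point (a , j)) ≡ Sample.block (stage a)
  point-block a j = All.lookup (Sample.inBlock (stage a)) (point-∈ a j)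

  threshold≤point : ∀ a j → threshold a ≤ point (a , j)
  threshold≤point a j = All.lookup (Sample.above (stage a)) (point-∈ a j)

  point<threshold : ∀ a j → point (a , j) < threshold (suc a)
  point<threshold a j = s≤s (All.lookup (xs≤max (threshold a) _) (point-∈ a j))

  point-<-stage : ∀ {a b} i j → a < b → point (a , i) < point (b , j)
  point-<-stage {a} {b} i j a<b =
    <-≤-trans (point<threshold a i) (≤-trans (mono-≤ a<b) (threshold≤point b j))

  point-injective : Injective _≡_ _≡_ point
  point-injective {a , i} {b , j} eq with <-cmp a b
  ... | tri< a<b _ _ = contradiction eq (<⇒≢ (point-<-stage i j a<b))
  ... | tri> _ _ b<a = contradiction (sym eq) (<⇒≢ (point-<-stage j i b<a))
  ... | tri≈ _ refl _ =
    cong (a ,_) (inject≤-injective _ _ i j (lookup-injective (Sample.unique (stage a)) eq))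

  stage≤point : ∀ a j → a ≤ point (a , j)
  stage≤point a j = ≤-trans (inflationary a) (threshold≤point a j)

  preimage? : ∀ β → Dec (∃ λ x → point x ≡ β)
  preimage? β =
    map′ (λ (a , j , eq) → (a , j) , eq) (λ ((a , j) , eq) → a , j , eq)
      (∃-bounded? (λ a → any? (λ j → point (a , j) ≟ β)) β
                  (λ {a} (j , eq) → subst (a ≤_) eq (stage≤point a j)))

  open ExtendAlong point point-injective preimage?

  diagonal : E
  diagonal α = point (α , fromℕ α)

  column : E
  column = extend (toℕ ∘ proj₂)

  asFin : ∀ {g} → E≤ g → ∀ α → Fin (suc α)
  asFin g≤ α = fromℕ< (s≤s (g≤ α))

  moveWithinStage : (g : E) → E≤ g → E
  moveWithinStage g g≤ = extend (λ (a , _) → point (a , asFin g≤ a))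

  moveWithinStage-preserves : ∀ g g≤ β → c (moveWithinStage g g≤ β) ≡ c β
  moveWithinStage-preserves g g≤ =
    extend-preserves (λ β v → c v ≡ c β) _
      (λ (a , j) → trans (point-block a _) (sym (point-block a j)))
      (λ _ → refl)

  decreasing⊆⟨preserving∪diagonal,column⟩ :
    E≤ ⊆ ⟨ (Eall ⦅ c ⦆) ∪L (diagonal ∷ column ∷ []) ⟩
  decreasing⊆⟨preserving∪diagonal,column⟩ g g≤ =
    diagonal ∷ moveWithinStage g g≤ ∷ column ∷ [] ,
    inj₂ (here refl) ∷ inj₁ (tt , moveWithinStage-preserves g g≤) ∷ inj₂ (there (here refl)) ∷ [] ,
    factorisation
    where
    open ≡-Reasoning
    factorisation : ∀ α → g α ≡ column (moveWithinStage g g≤ (diagonal α))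
    factorisation α = sym (begin
      column (moveWithinStage g g≤ (point (α , fromℕ α))) ≡⟨ cong column (extend-ι _ (α , fromℕ α)) ⟩
      column (point (α , asFin g≤ α))                    ≡⟨ extend-ι _ (α , asFin g≤ α) ⟩
      toℕ (asFin g≤ α)                                    ≡⟨ toℕ-fromℕ< (s≤s (g≤ α)) ⟩
      g α                                                 ∎)

lemma14 : (c : ℕ → ℕ) → FiniteBlocks c → UnboundedBlocks c →
    (Eall ⦅ c ⦆) ≈E E≤
lemma14 c finite unbounded =
  aboveBlock ∷ [] , diagonal ∷ column ∷ [] ,
  preserving⊆⟨decreasing∪aboveBlock⟩ , decreasing⊆⟨preserving∪diagonal,column⟩
  where
  open BlockPreserving c finite
  open DecreasingMaps c unbounded
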